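{- The function $H_{GP}:\mathbb{N}_0\times\{0,1\}^{\mathbb{N}}\to\mathbb{N}_0$ is monotone decreasing in its second argument: for all $n\in\mathbb{N}_0$ and all $\mathbf{b},\mathbf{c}\in\{0,1\}^{\mathbb{N}}$ with $\mathbf{b}\le\mathbf{c}$, we have $H_{GP}(n,\mathbf{b})\ge H_{GP}(n,\mathbf{c})$.
   Context: The partial order on $\{0,1\}^{\mathbb{N}}$ is $(b_1,b_2,\ldots)\le(c_1,c_2,\ldots)$ iff $b_i\le c_i$ for all $i\in\mathbb{N}$. For an infinite sequence $s=(s_1,s_2,\ldots)$, $\mathrm{ODD}(s)=(s_1,s_3,\ldots)$ and $\mathrm{EVEN}(s)=(s_2,s_4,\ldots)$; $a\mathbf{c}$ denotes the vector with first entry the bit $a$ followed by $\mathbf{c}$. $H_{GP}$ (the time complexity of the Gasieniec–Pelc rumor spreading algorithm with $k$ processors to inform and failure pattern $\mathbf{b}$, $0$ = failed, $1$ = successful request) is defined recursively by $H_{GP}(0,\mathbf{b})=0$ and, for $k>0$, $H_{GP}(k,0\mathbf{c})=1+H_{GP}(k-1,\mathbf{c})$ and $H_{GP}(k,1\mathbf{c})=1+\max\{H_{GP}(\lceil\tfrac{k-1}{2}\rceil,\mathrm{ODD}(\mathbf{c})),\,H_{GP}(\lfloor\tfrac{k-1}{2}\rfloor,\mathrm{EVEN}(\mathbf{c}))\}$. -}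

module Defs where

open import Data.Nat using (ℕ; zero; suc; _+_; _⊔_; _≤_; ⌊_/2⌋; ⌈_/2⌉)
open import Data.Bool using (Bool; true; false; _≤_)

-- Infinite 0/1 sequences {0,1}^ℕ, indexed from 0 (entry b_{i+1} is b i).
-- false = 0 (failed request), true = 1 (successful request).
Seq : Set
Seq = ℕ → Bool

_≤ˢ_ : Seq → Seq → Set
b ≤ˢ c = ∀ i → b i Data.Bool.≤ c i

tail : Seq → Seq
tail s i = s (suc i)

-- ODD(s) = (s_1, s_3, ...), EVEN(s) = (s_2, s_4, ...) (1-indexed)
ODD : Seq → Seq
ODD s i = s (i + i)

EVEN : Seq → Seq
EVEN s i = s (suc (i + i))

-- H_GP with a fuel argument to make termination structural.
-- With fuel ≥ k the fuel never runs out, since every recursive call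
-- has first argument ≤ k - 1.
HGP-fuel : ℕ → ℕ → Seq → ℕ
HGP-fuel _ zero b = 0
HGP-fuel zero (suc k) b = 0
HGP-fuel (suc f) (suc k) b with b 0
... | false = suc (HGP-fuel f k (tail b))
... | true  = suc (HGP-fuel f ⌈ k /2⌉ (ODD (tail b)) ⊔ HGP-fuel f ⌊ k /2⌋ (EVEN (tail b)))

HGP : ℕ → Seq → ℕ
HGP k b = HGP-fuel k k b

module Submission where

-- Write H for H_GP.  Comparing H(n, c) with H(n, b) for b ≤ c
-- by recursion on the first request, three cases are immediate (equal first
-- bits: recurse; first bit 1 in b but 0 in c: impossible).  The remaining
-- case, a failed request 0 in b against a successful one 1 in c, needs
--
--     H(⌈k/2⌉, ODD s) ⊔ H(⌊k/2⌋, EVEN s) ≤ H(k, s),                  (*)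
--
-- i.e. handing the remaining work to two halves that each see half of the
-- future requests is never slower than keeping it.  The odd part of (*) is
-- proved by strong induction on k, the even part at k+1 being a direct
-- consequence of the odd part at k; besides the recursion equations this
-- needs only that H depends on its sequence pointwise and the index
-- identity tail (ODD s) = EVEN (tail s).

open import Defs
open import Data.Nat using (ℕ; zero; suc; _+_; _⊔_; _≤_; _<_; z≤n; s≤s; ⌊_/2⌋; ⌈_/2⌉)
open import Data.Nat.Properties
  using (≤-refl; ≤-trans; n≤1+n; m<n⇒m<1+n; +-suc;
         ⌊n/2⌋≤n; ⌈n/2⌉≤n; ⊔-lub; ⊔-mono-≤; m≤m⊔n; m≤n⊔m; module ≤-Reasoning)
open import Data.Nat.Induction using (<-rec)
open import Data.Bool using (Bool; true; false) renaming (_≤_ to _≤ᵇ_)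
open import Data.Sum using (_⊎_; inj₁; inj₂)
open import Relation.Binary.PropositionalEquality
  using (_≡_; refl; cong; cong₂; subst₂; _≗_)

fuel-irrelevant : ∀ f g k s → k ≤ f → k ≤ g → HGP-fuel f k s ≡ HGP-fuel g k s
fuel-irrelevant f g zero s _ _ = refl
fuel-irrelevant (suc f) (suc g) (suc k) s (s≤s k≤f) (s≤s k≤g) with s 0
... | false = cong suc (fuel-irrelevant f g k (tail s) k≤f k≤g)
... | true  = cong suc (cong₂ _⊔_
  (fuel-irrelevant f g ⌈ k /2⌉ _ (≤-trans (⌈n/2⌉≤n k) k≤f) (≤-trans (⌈n/2⌉≤n k) k≤g))
  (fuel-irrelevant f g ⌊ k /2⌋ _ (≤-trans (⌊n/2⌋≤n k) k≤f) (≤-trans (⌊n/2⌋≤n k) k≤g)))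

HGP-failure : ∀ k s → s 0 ≡ false → HGP (suc k) s ≡ suc (HGP k (tail s))
HGP-failure k s s₀ rewrite s₀ = refl

HGP-success : ∀ k s → s 0 ≡ true →
  HGP (suc k) s ≡ suc (HGP ⌈ k /2⌉ (ODD (tail s)) ⊔ HGP ⌊ k /2⌋ (EVEN (tail s)))
HGP-success k s s₀ rewrite s₀ = cong suc (cong₂ _⊔_
  (fuel-irrelevant k ⌈ k /2⌉ ⌈ k /2⌉ _ (⌈n/2⌉≤n k) ≤-refl)
  (fuel-irrelevant k ⌊ k /2⌋ ⌊ k /2⌋ _ (⌊n/2⌋≤n k) ≤-refl))

-- H only looks at the entries of its sequence, so it respects pointwise
-- equality (sequences are functions, hence this is not automatic).
HGP-fuel-cong : ∀ f k {b c} → b ≗ c → HGP-fuel f k b ≡ HGP-fuel f k c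
HGP-fuel-cong f zero b≗c = refl
HGP-fuel-cong zero (suc k) b≗c = refl
HGP-fuel-cong (suc f) (suc k) {b} {c} b≗c with b 0 | c 0 | b≗c 0
... | false | .false | refl = cong suc (HGP-fuel-cong f k (λ i → b≗c (suc i)))
... | true  | .true  | refl = cong suc (cong₂ _⊔_
  (HGP-fuel-cong f ⌈ k /2⌉ (λ i → b≗c (suc (i + i))))
  (HGP-fuel-cong f ⌊ k /2⌋ (λ i → b≗c (suc (suc (i + i))))))

HGP-cong : ∀ k {b c} → b ≗ c → HGP k b ≡ HGP k c
HGP-cong k = HGP-fuel-cong k k

-- Every request either fails or succeeds; splitting on this (rather than
-- with-abstracting s 0) keeps the goals in terms of HGP.
fails-or-succeeds : ∀ (x : Bool) → x ≡ false ⊎ x ≡ true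
fails-or-succeeds false = inj₁ refl
fails-or-succeeds true  = inj₂ refl

tail-ODD : ∀ s → tail (ODD s) ≗ EVEN (tail s)
tail-ODD s i = cong (λ j → s (suc j)) (+-suc i i)

tail-mono : ∀ {b c} → b ≤ˢ c → tail b ≤ˢ tail c
tail-mono b≤c i = b≤c (suc i)

ODD-mono : ∀ {b c} → b ≤ˢ c → ODD b ≤ˢ ODD c
ODD-mono b≤c i = b≤c (i + i)

EVEN-mono : ∀ {b c} → b ≤ˢ c → EVEN b ≤ˢ EVEN c
EVEN-mono b≤c i = b≤c (suc (i + i))

OddBound : ℕ → Set
OddBound k = ∀ s → HGP ⌈ k /2⌉ (ODD s) ≤ HGP k s

EvenBound : ℕ → Set
EvenBound k = ∀ s → HGP ⌊ k /2⌋ (EVEN s) ≤ HGP k s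

-- The even bound at k follows from the odd bounds below k: after a first
-- request, EVEN s is literally ODD (tail s), and ⌊(k+1)/2⌋ is ⌈k/2⌉.
even-bound-from : ∀ {k} → (∀ {m} → m < k → OddBound m) → EvenBound k
even-bound-from {zero}  odd s = z≤n
even-bound-from {suc k} odd s with fails-or-succeeds (s 0)
... | inj₁ s₀ = begin
  HGP ⌈ k /2⌉ (EVEN s)        ≤⟨ odd ≤-refl (tail s) ⟩
  HGP k (tail s)              ≤⟨ n≤1+n _ ⟩
  suc (HGP k (tail s))        ≡⟨ HGP-failure k s s₀ ⟨
  HGP (suc k) s               ∎
  where open ≤-Reasoning
... | inj₂ s₀ = begin
  HGP ⌈ k /2⌉ (EVEN s)                                          ≤⟨ m≤m⊔n _ _ ⟩
  HGP ⌈ k /2⌉ (ODD (tail s)) ⊔ HGP ⌊ k /2⌋ (EVEN (tail s))       ≤⟨ n≤1+n _ ⟩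
  suc (HGP ⌈ k /2⌉ (ODD (tail s)) ⊔ HGP ⌊ k /2⌋ (EVEN (tail s))) ≡⟨ HGP-success k s s₀ ⟨
  HGP (suc k) s                                                 ∎
  where open ≤-Reasoning

-- With j = ⌊k/2⌋ we have ⌈(k+1)/2⌉ = j+1.
-- On a failure both sides recurse and the even bound at k applies (via
-- tail-ODD); on a success both halves of the left side are halvings of
-- EVEN (tail s) with j processors, hence bounded by the odd and even bounds
-- at j, and that term occurs on the right side.
odd-bound-step : ∀ k → (∀ {m} → m < k → OddBound m) → OddBound k
odd-bound-step zero    ih s = z≤n
odd-bound-step (suc k) ih s with fails-or-succeeds (s 0)
... | inj₁ s₀ = begin
  HGP (suc ⌊ k /2⌋) (ODD s)        ≡⟨ HGP-failure ⌊ k /2⌋ (ODD s) s₀ ⟩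
  suc (HGP ⌊ k /2⌋ (tail (ODD s))) ≡⟨ cong suc (HGP-cong ⌊ k /2⌋ (tail-ODD s)) ⟩
  suc (HGP ⌊ k /2⌋ (EVEN (tail s))) ≤⟨ s≤s (even-bound-from (λ m<k → ih (m<n⇒m<1+n m<k)) (tail s)) ⟩
  suc (HGP k (tail s))             ≡⟨ HGP-failure k s s₀ ⟨
  HGP (suc k) s                    ∎
  where open ≤-Reasoning
... | inj₂ s₀ = begin
  HGP (suc j) (ODD s)                                      ≡⟨ HGP-success j (ODD s) s₀ ⟩
  suc (HGP ⌈ j /2⌉ (ODD (tail (ODD s))) ⊔ HGP ⌊ j /2⌋ (EVEN (tail (ODD s))))
                                                           ≤⟨ s≤s (⊔-lub odd-half even-half) ⟩
  suc (HGP j (EVEN (tail s)))                              ≤⟨ s≤s (m≤n⊔m _ _) ⟩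
  suc (HGP ⌈ k /2⌉ (ODD (tail s)) ⊔ HGP j (EVEN (tail s))) ≡⟨ HGP-success k s s₀ ⟨
  HGP (suc k) s                                            ∎
  where
  open ≤-Reasoning
  j : ℕ
  j = ⌊ k /2⌋

  j≤1+k : j ≤ suc k
  j≤1+k = ≤-trans (⌊n/2⌋≤n k) (n≤1+n k)

  j<1+k : j < suc k
  j<1+k = s≤s (⌊n/2⌋≤n k)

  odd-half : HGP ⌈ j /2⌉ (ODD (tail (ODD s))) ≤ HGP j (EVEN (tail s))
  odd-half = begin
    HGP ⌈ j /2⌉ (ODD (tail (ODD s)))  ≡⟨ HGP-cong ⌈ j /2⌉ (λ i → tail-ODD s (i + i)) ⟩
    HGP ⌈ j /2⌉ (ODD (EVEN (tail s))) ≤⟨ ih j<1+k (EVEN (tail s)) ⟩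
    HGP j (EVEN (tail s))             ∎

  even-half : HGP ⌊ j /2⌋ (EVEN (tail (ODD s))) ≤ HGP j (EVEN (tail s))
  even-half = begin
    HGP ⌊ j /2⌋ (EVEN (tail (ODD s)))  ≡⟨ HGP-cong ⌊ j /2⌋ (λ i → tail-ODD s (suc (i + i))) ⟩
    HGP ⌊ j /2⌋ (EVEN (EVEN (tail s))) ≤⟨ even-bound-from (λ m<j → ih (≤-trans m<j j≤1+k)) _ ⟩
    HGP j (EVEN (tail s))              ∎

odd-bound : ∀ k → OddBound k
odd-bound = <-rec OddBound odd-bound-step

even-bound : ∀ k → EvenBound k
even-bound k = even-bound-from {k} (λ {m} _ → odd-bound m)

-- (*): splitting the remaining work between the two halves is never slower
-- than keeping it, i.e. a successful request never costs more than a failed one.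
halves≤ : ∀ k s → HGP ⌈ k /2⌉ (ODD s) ⊔ HGP ⌊ k /2⌋ (EVEN s) ≤ HGP k s
halves≤ k s = ⊔-lub (odd-bound k s) (even-bound k s)

Antitone : ℕ → Set
Antitone n = ∀ b c → b ≤ˢ c → HGP n c ≤ HGP n b

halves-antitone : ∀ k → (∀ {m} → m ≤ k → Antitone m) → ∀ {b c} → b ≤ˢ c →
  HGP ⌈ k /2⌉ (ODD c) ⊔ HGP ⌊ k /2⌋ (EVEN c) ≤ HGP ⌈ k /2⌉ (ODD b) ⊔ HGP ⌊ k /2⌋ (EVEN b)
halves-antitone k anti b≤c =
  ⊔-mono-≤ (anti (⌈n/2⌉≤n k) _ _ (ODD-mono b≤c)) (anti (⌊n/2⌋≤n k) _ _ (EVEN-mono b≤c))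

-- Equal bits recurse;
-- b₀ = 1 > c₀ = 0 is excluded; for b₀ = 0 < c₀ = 1 compare c's success
-- branch with b's success branch, which is at most b's failure branch by (*).
antitone-step : ∀ n → (∀ {m} → m < n → Antitone m) → Antitone n
antitone-step zero    ih b c b≤c = z≤n
antitone-step (suc n) ih b c b≤c with fails-or-succeeds (b 0) | fails-or-succeeds (c 0)
... | inj₂ b₀ | inj₁ c₀ with subst₂ _≤ᵇ_ b₀ c₀ (b≤c 0)
...   | ()
antitone-step (suc n) ih b c b≤c | inj₁ b₀ | inj₁ c₀ = begin
  HGP (suc n) c        ≡⟨ HGP-failure n c c₀ ⟩
  suc (HGP n (tail c)) ≤⟨ s≤s (ih ≤-refl _ _ (tail-mono b≤c)) ⟩
  suc (HGP n (tail b)) ≡⟨ HGP-failure n b b₀ ⟨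
  HGP (suc n) b        ∎
  where open ≤-Reasoning
antitone-step (suc n) ih b c b≤c | inj₂ b₀ | inj₂ c₀ = begin
  HGP (suc n) c                                                 ≡⟨ HGP-success n c c₀ ⟩
  suc (HGP ⌈ n /2⌉ (ODD (tail c)) ⊔ HGP ⌊ n /2⌋ (EVEN (tail c))) ≤⟨ s≤s (halves-antitone n (λ m≤n → ih (s≤s m≤n)) (tail-mono b≤c)) ⟩
  suc (HGP ⌈ n /2⌉ (ODD (tail b)) ⊔ HGP ⌊ n /2⌋ (EVEN (tail b))) ≡⟨ HGP-success n b b₀ ⟨
  HGP (suc n) b                                                 ∎
  where open ≤-Reasoning
antitone-step (suc n) ih b c b≤c | inj₁ b₀ | inj₂ c₀ = begin
  HGP (suc n) c                                                 ≡⟨ HGP-success n c c₀ ⟩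
  suc (HGP ⌈ n /2⌉ (ODD (tail c)) ⊔ HGP ⌊ n /2⌋ (EVEN (tail c))) ≤⟨ s≤s (halves-antitone n (λ m≤n → ih (s≤s m≤n)) (tail-mono b≤c)) ⟩
  suc (HGP ⌈ n /2⌉ (ODD (tail b)) ⊔ HGP ⌊ n /2⌋ (EVEN (tail b))) ≤⟨ s≤s (halves≤ n (tail b)) ⟩
  suc (HGP n (tail b))                                          ≡⟨ HGP-failure n b b₀ ⟨
  HGP (suc n) b                                                 ∎
  where open ≤-Reasoning

lemma10 : (n : ℕ) (b c : Seq) → b ≤ˢ c → HGP n c ≤ HGP n b
lemma10 = <-rec Antitone antitone-step
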